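{- Let $n,k$ be odd integers with $k\ge1$, $n>2k$, and $k\mid n$. Then $\beta(P(n,k))=n+\frac{k+1}{2}$.
   Context: $P(n,k)$ is the generalized Petersen graph with vertices $u_1,\dots,u_n,v_1,\dots,v_n$ and edges $u_iu_{i+1}$, $u_iv_i$, $v_iv_{i+k}$ (subscripts modulo $n$). $\beta(G)$ denotes the size of a minimum vertex cover of $G$. -}

module Defs where

open import Data.Nat using (ℕ; suc; _+_; _≤_; NonZero)
open import Data.Nat.DivMod using (_%_)
open import Data.Fin using (Fin; toℕ; _↑ˡ_; _↑ʳ_)
open import Data.Fin.Subset using (Subset; _∈_; ∣_∣)
open import Data.Product using (_×_; Σ-syntax)
open import Data.Sum using (_⊎_)
open import Relation.Binary.PropositionalEquality using (_≡_)

Graph : ℕ → Set₁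
Graph N = Fin N → Fin N → Set

IsVertexCover : ∀ {N} → Graph N → Subset N → Set
IsVertexCover {N} E S = ∀ (x y : Fin N) → E x y → x ∈ S ⊎ y ∈ S

IsMinVertexCoverSize : ∀ {N} → Graph N → ℕ → Set
IsMinVertexCoverSize {N} E m =
  (Σ[ S ∈ Subset N ] (IsVertexCover E S × ∣ S ∣ ≡ m))
  × (∀ (S : Subset N) → IsVertexCover E S → m ≤ ∣ S ∣)

-- Generalized Petersen graph P(n,k) on 2n vertices:
-- u_i is  i ↑ˡ n  (index i), v_i is  n ↑ʳ i  (index n + i), for i : Fin n.
-- Edges u_i u_{i+1}, u_i v_i, v_i v_{i+k}, subscripts mod n.
data PEdge (n k : ℕ) .{{_ : NonZero n}} : Fin (n + n) → Fin (n + n) → Set where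
  outer : (i j : Fin n) → toℕ j ≡ (toℕ i + 1) % n → PEdge n k (i ↑ˡ n) (j ↑ˡ n)
  spoke : (i : Fin n) → PEdge n k (i ↑ˡ n) (n ↑ʳ i)
  inner : (i j : Fin n) → toℕ j ≡ (toℕ i + k) % n → PEdge n k (n ↑ʳ i) (n ↑ʳ j)

Petersen : (n k : ℕ) .{{_ : NonZero n}} → Graph (n + n)
Petersen n k = PEdge n k

module Submission where

-- Write n = 2a+1, k = 2b+1 and n = qk; q is odd, q = 2c+1, and
-- n + (k+1)/2 = (a+1) + k(c+1).
--
-- A vertex cover S is read as a 0/1 weight χ S on vertex
-- indices, so ∣S∣ is a finite sum ∑.  An odd cycle of length 2c+1 whose edges
-- all carry weight ≥ 1 has total weight ≥ c+1 (summing over the edges counts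
-- every vertex twice).  If every pair i, i+k (mod n) carries weight ≥ 1 and
-- n = (2c+1)k, the residue classes mod k are k such odd cycles, giving total
-- weight ≥ k(c+1) ('circulant-bound').  The outer rim is the case k = 1
-- (weight ≥ a+1) and the inner rims the general case (weight ≥ k(c+1)).
--
-- Take u_i for even i, and v_j for odd j or j ≥ n - k.  Rim
-- neighbours i, i+1 and inner neighbours i, i+k (k odd, no wrap-around) have
-- opposite parity, u_0 covers the closing rim edge, spokes are covered by
-- parity, and the set has (a+1) + ((n-k)/2 + k) = (a+1) + k(c+1) elements.

open import Defs
open import Data.Nat using (ℕ; zero; suc; _+_; _*_; _/_; _%_; _≤_; _<_; NonZero; z≤n; s≤s; z<s; s<s)
open import Data.Nat.Properties
open import Data.Nat.DivMod using (m≡m%n+[m/n]*n; m<n⇒m%n≡m; n%n≡0; m%n<n; [m+n]%n≡m%n; %-distribˡ-*; m%n%n≡m%n; m*n/n≡m)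
open import Data.Nat.Divisibility using (_∣_; divides)
open import Data.Nat.Tactic.RingSolver using (solve-∀)
open import Algebra.Properties.CommutativeSemigroup +-commutativeSemigroup using (interchange)
open import Data.Bool using (Bool; true; false; _∨_; T)
open import Data.Bool.Properties using (T-∨; T-≡; ∨-identityʳ; ∨-zeroʳ)
open import Data.Fin using (Fin; toℕ; fromℕ<; _↑ˡ_; _↑ʳ_)
open import Data.Fin.Properties using (toℕ-↑ˡ; toℕ-↑ʳ; toℕ-fromℕ<; toℕ<n)
open import Data.Fin.Subset using (Subset; ∣_∣; _∈_)
open import Data.Vec using ([]; _∷_; _++_; tabulate; here; there)
open import Data.Vec.Properties using (lookup-++ˡ; lookup-++ʳ; lookup∘tabulate; lookup⇒[]=)
open import Data.Product using (∃-syntax; _,_)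
open import Data.Sum using (_⊎_; inj₁; inj₂; swap) renaming (map to ⊎-map)
open import Function using (_∘_)
open import Function.Bundles using (Equivalence)
open import Relation.Nullary using (yes; no; does)
open import Relation.Nullary.Decidable using (dec-true; dec-false)
open import Relation.Binary.PropositionalEquality

∑ : ℕ → (ℕ → ℕ) → ℕ
∑ zero    f = 0
∑ (suc n) f = f 0 + ∑ n (λ i → f (suc i))

∑-cong : ∀ n {f g : ℕ → ℕ} → (∀ i → i < n → f i ≡ g i) → ∑ n f ≡ ∑ n g
∑-cong zero    eq = refl
∑-cong (suc n) eq = cong₂ _+_ (eq 0 z<s) (∑-cong n (λ i i<n → eq (suc i) (s<s i<n)))

∑-mono : ∀ n {f g : ℕ → ℕ} → (∀ i → i < n → f i ≤ g i) → ∑ n f ≤ ∑ n g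
∑-mono zero    le = z≤n
∑-mono (suc n) le = +-mono-≤ (le 0 z<s) (∑-mono n (λ i i<n → le (suc i) (s<s i<n)))

∑-const : ∀ n c → ∑ n (λ _ → c) ≡ n * c
∑-const zero    c = refl
∑-const (suc n) c = cong (c +_) (∑-const n c)

∑-lower : ∀ n c {f : ℕ → ℕ} → (∀ i → i < n → c ≤ f i) → n * c ≤ ∑ n f
∑-lower n c le = subst (_≤ ∑ n _) (∑-const n c) (∑-mono n le)

∑-split : ∀ m n f → ∑ (m + n) f ≡ ∑ m f + ∑ n (λ i → f (m + i))
∑-split zero    n f = refl
∑-split (suc m) n f =
  trans (cong (f 0 +_) (∑-split m n (λ i → f (suc i)))) (sym (+-assoc (f 0) _ _))

∑-snoc : ∀ n f → ∑ (suc n) f ≡ ∑ n f + f n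
∑-snoc zero    f = +-identityʳ (f 0)
∑-snoc (suc n) f =
  trans (cong (f 0 +_) (∑-snoc n (λ i → f (suc i)))) (sym (+-assoc (f 0) _ _))

∑-distrib : ∀ n f g → ∑ n (λ i → f i + g i) ≡ ∑ n f + ∑ n g
∑-distrib zero    f g = refl
∑-distrib (suc n) f g =
  trans (cong (f 0 + g 0 +_) (∑-distrib n (λ i → f (suc i)) (λ i → g (suc i))))
        (interchange (f 0) (g 0) _ _)

∑-blocks : ∀ m k f → ∑ (m * k) f ≡ ∑ m (λ j → ∑ k (λ r → f (j * k + r)))
∑-blocks zero    k f = refl
∑-blocks (suc m) k f = begin
  ∑ (k + m * k) f                                      ≡⟨ ∑-split k (m * k) f ⟩
  ∑ k f + ∑ (m * k) (λ i → f (k + i))                  ≡⟨ cong (∑ k f +_) (∑-blocks m k _) ⟩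
  ∑ k f + ∑ m (λ j → ∑ k (λ r → f (k + (j * k + r))))  ≡⟨ cong (∑ k f +_) (∑-cong m λ j _ →
                                                           ∑-cong k λ r _ → cong f (sym (+-assoc k (j * k) r))) ⟩
  ∑ k f + ∑ m (λ j → ∑ k (λ r → f (suc j * k + r)))    ∎
  where open ≡-Reasoning

∑-swap : ∀ m k (h : ℕ → ℕ → ℕ) → ∑ m (λ j → ∑ k (h j)) ≡ ∑ k (λ r → ∑ m (λ j → h j r))
∑-swap zero    k h = sym (trans (∑-const k 0) (*-zeroʳ k))
∑-swap (suc m) k h =
  trans (cong (∑ k (h 0) +_) (∑-swap m k (λ j → h (suc j))))
        (sym (∑-distrib k (h 0) (λ r → ∑ m (λ j → h (suc j) r))))

-- Weights on the cycle 0 – 1 – … – p – 0 giving every edge weight ≥ 1 have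
-- twice their total at least the length: each vertex lies on two edges.
cycle-double : ∀ p (h : ℕ → ℕ) → (∀ j → j < p → 1 ≤ h j + h (suc j)) → 1 ≤ h p + h 0 →
               suc p ≤ ∑ (suc p) h + ∑ (suc p) h
cycle-double p h path close = begin
  suc p                                          ≡⟨ cong suc (*-identityʳ p) ⟨
  suc (p * 1)                                    ≡⟨ +-comm 1 (p * 1) ⟩
  p * 1 + 1                                      ≤⟨ +-mono-≤ (∑-lower p 1 path) close ⟩
  ∑ p (λ j → h j + h (suc j)) + (h p + h 0)      ≡⟨ cong (_+ (h p + h 0)) (∑-distrib p h (h ∘ suc)) ⟩
  ∑ p h + ∑ p (h ∘ suc) + (h p + h 0)            ≡⟨ interchange (∑ p h) _ (h p) _ ⟩
  (∑ p h + h p) + (∑ p (h ∘ suc) + h 0)          ≡⟨ cong₂ _+_ (∑-snoc p h) (+-comm (h 0) _) ⟨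
  ∑ (suc p) h + ∑ (suc p) h                      ∎
  where open ≤-Reasoning

odd-cycle-bound : ∀ c (h : ℕ → ℕ) → (∀ j → j < c + c → 1 ≤ h j + h (suc j)) →
                  1 ≤ h (c + c) + h 0 → suc c ≤ ∑ (suc (c + c)) h
odd-cycle-bound c h path close =
  ≰⇒> (λ s≤c → <⇒≱ (cycle-double (c + c) h path close) (+-mono-≤ s≤c s≤c))

-- If every pair i, i+k (mod n) has weight ≥ 1 and n = (2c+1)k, then for each
-- r < k the indices r, r+k, …, r+2ck form an odd cycle of length 2c+1; the k
-- cycles partition 0 … n-1, so the total weight is at least k(c+1).
circulant-bound : ∀ n k c .{{_ : NonZero n}} (h : ℕ → ℕ) → n ≡ suc (c + c) * k →
                  (∀ i → i < n → 1 ≤ h i + h ((i + k) % n)) → k * suc c ≤ ∑ n h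
circulant-bound n k c h n≡qk covered = begin
  k * suc c                                ≤⟨ ∑-lower k (suc c) residue-cycle ⟩
  ∑ k (λ r → ∑ q (λ j → h (j * k + r)))    ≡⟨ ∑-swap q k (λ j r → h (j * k + r)) ⟨
  ∑ q (λ j → ∑ k (λ r → h (j * k + r)))    ≡⟨ ∑-blocks q k h ⟨
  ∑ (q * k) h                              ≡⟨ cong (λ m → ∑ m h) n≡qk ⟨
  ∑ n h                                    ∎
  where
  open ≤-Reasoning
  q : ℕ
  q = suc (c + c)

  k≤n : k ≤ n
  k≤n = subst (k ≤_) (sym n≡qk) (m≤m+n k ((c + c) * k))

  in-range : ∀ {j r} → j < q → r < k → j * k + r < n
  in-range {j} {r} j<q r<k = begin-strict
    j * k + r   <⟨ +-monoʳ-< (j * k) r<k ⟩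
    j * k + k   ≡⟨ +-comm (j * k) k ⟩
    suc j * k   ≤⟨ *-monoˡ-≤ k j<q ⟩
    q * k       ≡⟨ n≡qk ⟨
    n           ∎

  next-block : ∀ j k r → j * k + r + k ≡ suc j * k + r
  next-block = solve-∀

  residue-cycle : ∀ r → r < k → suc c ≤ ∑ q (λ j → h (j * k + r))
  residue-cycle r r<k = odd-cycle-bound c (λ j → h (j * k + r)) path close
    where
    path : ∀ j → j < c + c → 1 ≤ h (j * k + r) + h (suc j * k + r)
    path j j<2c = subst (λ x → 1 ≤ h (j * k + r) + h x)
      (trans (cong (_% n) (next-block j k r)) (m<n⇒m%n≡m (in-range (s<s j<2c) r<k)))
      (covered (j * k + r) (in-range (m<n⇒m<1+n j<2c) r<k))

    wrap : ((c + c) * k + r + k) % n ≡ r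
    wrap = begin-equality
      ((c + c) * k + r + k) % n   ≡⟨ cong (_% n) (next-block (c + c) k r) ⟩
      (q * k + r) % n             ≡⟨ cong (λ m → (m + r) % n) n≡qk ⟨
      (n + r) % n                 ≡⟨ cong (_% n) (+-comm n r) ⟩
      (r + n) % n                 ≡⟨ [m+n]%n≡m%n r n ⟩
      r % n                       ≡⟨ m<n⇒m%n≡m (<-≤-trans r<k k≤n) ⟩
      r                           ∎

    close : 1 ≤ h ((c + c) * k + r) + h r
    close = subst (λ x → 1 ≤ h ((c + c) * k + r) + h x) wrap
      (covered ((c + c) * k + r) (in-range ≤-refl r<k))

ind : Bool → ℕ
ind true  = 1
ind false = 0

-- χ S i is the weight (0 or 1) of the i-th element of S, and 0 past the end.
χ : ∀ {N} → Subset N → ℕ → ℕ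
χ []      _       = 0
χ (b ∷ S) zero    = ind b
χ (b ∷ S) (suc i) = χ S i

∣∷∣ : ∀ {N} b (S : Subset N) → ∣ b ∷ S ∣ ≡ ind b + ∣ S ∣
∣∷∣ true  S = refl
∣∷∣ false S = refl

∣S∣≡∑χ : ∀ {N} (S : Subset N) → ∣ S ∣ ≡ ∑ N (χ S)
∣S∣≡∑χ []      = refl
∣S∣≡∑χ (b ∷ S) = trans (∣∷∣ b S) (cong (ind b +_) (∣S∣≡∑χ S))

χ-∈ : ∀ {N} {S : Subset N} {x} → x ∈ S → χ S (toℕ x) ≡ 1
χ-∈ here        = refl
χ-∈ (there x∈S) = χ-∈ x∈S

edge-weight : ∀ {N} {E : Graph N} {S} → IsVertexCover E S →
              ∀ {x y} → E x y → 1 ≤ χ S (toℕ x) + χ S (toℕ y)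
edge-weight {S = S} cov {x} {y} e with cov x y e
... | inj₁ x∈S = subst (λ w → 1 ≤ w + χ S (toℕ y)) (sym (χ-∈ x∈S)) (s≤s z≤n)
... | inj₂ y∈S = subst (λ w → 1 ≤ χ S (toℕ x) + w) (sym (χ-∈ y∈S)) (m≤n+m 1 _)

∣++∣ : ∀ {m n} (S : Subset m) (S′ : Subset n) → ∣ S ++ S′ ∣ ≡ ∣ S ∣ + ∣ S′ ∣
∣++∣ []      S′ = refl
∣++∣ (b ∷ S) S′ = begin
  ∣ b ∷ (S ++ S′) ∣        ≡⟨ ∣∷∣ b (S ++ S′) ⟩
  ind b + ∣ S ++ S′ ∣      ≡⟨ cong (ind b +_) (∣++∣ S S′) ⟩
  ind b + (∣ S ∣ + ∣ S′ ∣) ≡⟨ +-assoc (ind b) _ _ ⟨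
  ind b + ∣ S ∣ + ∣ S′ ∣   ≡⟨ cong (_+ ∣ S′ ∣) (∣∷∣ b S) ⟨
  ∣ b ∷ S ∣ + ∣ S′ ∣       ∎
  where open ≡-Reasoning

∣tabulate∣ : ∀ N (g : ℕ → Bool) → ∣ tabulate {n = N} (λ x → g (toℕ x)) ∣ ≡ ∑ N (λ i → ind (g i))
∣tabulate∣ zero    g = refl
∣tabulate∣ (suc N) g = trans (∣∷∣ {N} (g 0) (tabulate (λ x → g (suc (toℕ x)))))
                             (cong (ind (g 0) +_) (∣tabulate∣ N (g ∘ suc)))

module LowerBound (n k : ℕ) .{{_ : NonZero n}} {S : Subset (n + n)}
                  (cov : IsVertexCover (Petersen n k) S) where

  outer-weight : ∀ i → i < n → 1 ≤ χ S i + χ S ((i + 1) % n)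
  outer-weight i i<n =
    subst₂ (λ x y → 1 ≤ χ S x + χ S y)
      (trans (toℕ-↑ˡ (fromℕ< i<n) n) (toℕ-fromℕ< i<n))
      (trans (toℕ-↑ˡ (fromℕ< i+1<n) n) (toℕ-fromℕ< i+1<n))
      (edge-weight cov (outer (fromℕ< i<n) (fromℕ< i+1<n) next))
    where
    i+1<n : (i + 1) % n < n
    i+1<n = m%n<n (i + 1) n
    next : toℕ (fromℕ< i+1<n) ≡ (toℕ (fromℕ< i<n) + 1) % n
    next = trans (toℕ-fromℕ< i+1<n) (cong (λ x → (x + 1) % n) (sym (toℕ-fromℕ< i<n)))

  inner-weight : ∀ i → i < n → 1 ≤ χ S (n + i) + χ S (n + (i + k) % n)
  inner-weight i i<n =
    subst₂ (λ x y → 1 ≤ χ S x + χ S y)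
      (trans (toℕ-↑ʳ n (fromℕ< i<n)) (cong (n +_) (toℕ-fromℕ< i<n)))
      (trans (toℕ-↑ʳ n (fromℕ< i+k<n)) (cong (n +_) (toℕ-fromℕ< i+k<n)))
      (edge-weight cov (inner (fromℕ< i<n) (fromℕ< i+k<n) next))
    where
    i+k<n : (i + k) % n < n
    i+k<n = m%n<n (i + k) n
    next : toℕ (fromℕ< i+k<n) ≡ (toℕ (fromℕ< i<n) + k) % n
    next = trans (toℕ-fromℕ< i+k<n) (cong (λ x → (x + k) % n) (sym (toℕ-fromℕ< i<n)))

  -- the outer rim is an odd cycle of length 2a+1, the inner rims are k odd
  -- cycles of length 2c+1
  lower-bound : ∀ a c → n ≡ suc (a + a) → n ≡ suc (c + c) * k → suc a + k * suc c ≤ ∣ S ∣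
  lower-bound a c n≡2a+1 n≡qk = begin
    suc a + k * suc c                        ≤⟨ +-mono-≤ rim inner-rims ⟩
    ∑ n (χ S) + ∑ n (λ i → χ S (n + i))      ≡⟨ ∑-split n n (χ S) ⟨
    ∑ (n + n) (χ S)                          ≡⟨ ∣S∣≡∑χ S ⟨
    ∣ S ∣                                    ∎
    where
    open ≤-Reasoning
    rim : suc a ≤ ∑ n (χ S)
    rim = subst (_≤ ∑ n (χ S)) (*-identityˡ (suc a))
      (circulant-bound n 1 a (χ S) (trans n≡2a+1 (sym (*-identityʳ _))) outer-weight)
    inner-rims : k * suc c ≤ ∑ n (λ i → χ S (n + i))
    inner-rims = circulant-bound n k c (λ i → χ S (n + i)) n≡qk inner-weight

even odd : ℕ → Bool
even zero    = true
even (suc n) = odd n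
odd  zero    = false
odd  (suc n) = even n

even⊎odd : ∀ i → T (even i) ⊎ T (odd i)
even⊎odd zero    = inj₁ _
even⊎odd (suc i) = swap (even⊎odd i)

even-+-double : ∀ b i → even (b + b + i) ≡ even i
even-+-double zero    i = refl
even-+-double (suc b) i = trans (cong (λ m → odd (m + i)) (+-suc b b)) (even-+-double b i)

odd-+-odd : ∀ b i → odd (i + suc (b + b)) ≡ even i
odd-+-odd b i = trans (cong odd (+-comm i (suc (b + b)))) (even-+-double b i)

count-odd : ∀ d → ∑ (d + d) (λ i → ind (odd i)) ≡ d
count-odd zero    = refl
count-odd (suc d) =
  trans (cong (λ m → ∑ m (λ i → ind (even i))) (+-suc d d)) (cong suc (count-odd d))

succ-mod : ∀ {n} .{{_ : NonZero n}} i → i < n → (i + 1) % n ≡ suc i ⊎ (i + 1) % n ≡ 0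
succ-mod {n} i i<n with suc i <? n
... | yes i+1<n = inj₁ (trans (cong (_% n) (+-comm i 1)) (m<n⇒m%n≡m i+1<n))
... | no  i+1≮n = inj₂ (trans (cong (_% n) (trans (+-comm i 1) (≤-antisym i<n (≮⇒≥ i+1≮n)))) (n%n≡0 n))

module EvenOddCover (n k b d : ℕ) .{{_ : NonZero n}}
                    (k≡2b+1 : k ≡ suc (b + b)) (n≡2d+k : n ≡ d + d + k) where

  inV : ℕ → Bool
  inV j = odd j ∨ does (d + d ≤? j)

  u-part v-part : Subset n
  u-part = tabulate (λ i → even (toℕ i))
  v-part = tabulate (λ j → inV (toℕ j))

  cover : Subset (n + n)
  cover = u-part ++ v-part

  u∈cover : (i : Fin n) → T (even (toℕ i)) → (i ↑ˡ n) ∈ cover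
  u∈cover i t = lookup⇒[]= (i ↑ˡ n) cover
    (trans (lookup-++ˡ u-part v-part i) (trans (lookup∘tabulate (λ i → even (toℕ i)) i) (Equivalence.to T-≡ t)))

  v∈cover : (j : Fin n) → T (inV (toℕ j)) → (n ↑ʳ j) ∈ cover
  v∈cover j t = lookup⇒[]= (n ↑ʳ j) cover
    (trans (lookup-++ʳ u-part v-part j) (trans (lookup∘tabulate (λ j → inV (toℕ j)) j) (Equivalence.to T-≡ t)))

  odd-v∈cover : (j : Fin n) → T (odd (toℕ j)) → (n ↑ʳ j) ∈ cover
  odd-v∈cover j t = v∈cover j (Equivalence.from (T-∨ {odd (toℕ j)}) (inj₁ t))

  late-v∈cover : (j : Fin n) → d + d ≤ toℕ j → (n ↑ʳ j) ∈ cover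
  late-v∈cover j le = v∈cover j (Equivalence.from (T-∨ {odd (toℕ j)}) (inj₂ (Equivalence.from T-≡ (dec-true (d + d ≤? toℕ j) le))))

  is-cover : IsVertexCover (Petersen n k) cover
  is-cover _ _ (outer i j j≡) with succ-mod (toℕ i) (toℕ<n i)
  ... | inj₁ step = ⊎-map (u∈cover i) (u∈cover j ∘ subst (T ∘ even) (sym (trans j≡ step)))
                          (even⊎odd (toℕ i))
  ... | inj₂ wrap = inj₂ (u∈cover j (subst (T ∘ even) (sym (trans j≡ wrap)) _))
  is-cover _ _ (spoke i) = ⊎-map (u∈cover i) (odd-v∈cover i) (even⊎odd (toℕ i))
  is-cover _ _ (inner i j j≡) with d + d ≤? toℕ i
  ... | yes late  = inj₁ (late-v∈cover i late)
  ... | no  early = ⊎-map (odd-v∈cover i) (odd-v∈cover j ∘ j-odd) (swap (even⊎odd (toℕ i)))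
    where
    i+k<n : toℕ i + k < n
    i+k<n = subst (toℕ i + k <_) (sym n≡2d+k) (+-monoˡ-< k (≰⇒> early))
    j-odd : T (even (toℕ i)) → T (odd (toℕ j))
    j-odd = subst T (sym (begin
      odd (toℕ j)                ≡⟨ cong odd (trans j≡ (m<n⇒m%n≡m i+k<n)) ⟩
      odd (toℕ i + k)            ≡⟨ cong (λ m → odd (toℕ i + m)) k≡2b+1 ⟩
      odd (toℕ i + suc (b + b))  ≡⟨ odd-+-odd b (toℕ i) ⟩
      even (toℕ i)               ∎))
      where open ≡-Reasoning

  -- a + 1 even rim indices when n = 2a+1; d odd plus k late inner indices
  size : ∀ a → n ≡ suc (a + a) → ∣ cover ∣ ≡ suc a + (d + k)
  size a n≡2a+1 = begin
    ∣ cover ∣                                             ≡⟨ ∣++∣ u-part v-part ⟩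
    ∣ u-part ∣ + ∣ v-part ∣                               ≡⟨ cong₂ _+_ (∣tabulate∣ n even) (∣tabulate∣ n inV) ⟩
    ∑ n (λ i → ind (even i)) + ∑ n (λ j → ind (inV j))    ≡⟨ cong₂ _+_ even-count v-count ⟩
    suc a + (d + k)                                       ∎
    where
    open ≡-Reasoning
    even-count : ∑ n (λ i → ind (even i)) ≡ suc a
    even-count = trans (cong (λ m → ∑ m (λ i → ind (even i))) n≡2a+1) (cong suc (count-odd a))

    v-count : ∑ n (λ j → ind (inV j)) ≡ d + k
    v-count = begin
      ∑ n f                                       ≡⟨ cong (λ m → ∑ m f) n≡2d+k ⟩
      ∑ (d + d + k) f                             ≡⟨ ∑-split (d + d) k f ⟩
      ∑ (d + d) f + ∑ k (λ j → f (d + d + j))     ≡⟨ cong₂ _+_ (∑-cong (d + d) early) (∑-cong k late) ⟩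
      ∑ (d + d) (λ j → ind (odd j)) + ∑ k (λ _ → 1)  ≡⟨ cong₂ _+_ (count-odd d) (trans (∑-const k 1) (*-identityʳ k)) ⟩
      d + k                                       ∎
      where
      f : ℕ → ℕ
      f j = ind (inV j)
      early : ∀ j → j < d + d → f j ≡ ind (odd j)
      early j j<2d = cong ind (trans (cong (odd j ∨_) (dec-false (d + d ≤? j) (<⇒≱ j<2d)))
                                     (∨-identityʳ (odd j)))
      late : ∀ j → j < k → f (d + d + j) ≡ 1
      late j _ = cong ind (trans (cong (odd (d + d + j) ∨_) (dec-true (d + d ≤? d + d + j) (m≤m+n (d + d) j)))
                                 (∨-zeroʳ (odd (d + d + j))))

odd-half : ∀ {n} → n % 2 ≡ 1 → ∃[ a ] n ≡ suc (a + a)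
odd-half {n} n-odd = n / 2 , (begin
  n                    ≡⟨ m≡m%n+[m/n]*n n 2 ⟩
  n % 2 + n / 2 * 2    ≡⟨ cong₂ _+_ n-odd (*-comm (n / 2) 2) ⟩
  1 + 2 * (n / 2)      ≡⟨ cong (λ x → suc (n / 2 + x)) (+-identityʳ (n / 2)) ⟩
  suc (n / 2 + n / 2)  ∎)
  where open ≡-Reasoning

odd-cofactor : ∀ {q k} → (q * k) % 2 ≡ 1 → k % 2 ≡ 1 → q % 2 ≡ 1
odd-cofactor {q} {k} qk-odd k-odd = begin
  q % 2                  ≡⟨ m%n%n≡m%n q 2 ⟨
  q % 2 % 2              ≡⟨ cong (_% 2) (*-identityʳ (q % 2)) ⟨
  (q % 2 * 1) % 2        ≡⟨ cong (λ x → (q % 2 * x) % 2) k-odd ⟨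
  (q % 2 * (k % 2)) % 2  ≡⟨ %-distribˡ-* q k 2 ⟨
  (q * k) % 2            ≡⟨ qk-odd ⟩
  1                      ∎
  where open ≡-Reasoning

target-value : ∀ {n k a b c} → n ≡ suc (a + a) → k ≡ suc (b + b) → n ≡ suc (c + c) * k →
               n + (k + 1) / 2 ≡ suc a + k * suc c
target-value {a = a} {b} {c} refl refl n≡qk =
  trans (cong (suc (a + a) +_) half-k) (*-cancelˡ-≡ _ _ 2 doubled)
  where
  open ≡-Reasoning
  k+1≡ : ∀ b → suc (b + b) + 1 ≡ suc b * 2
  k+1≡ = solve-∀
  half-k : (suc (b + b) + 1) / 2 ≡ suc b
  half-k = trans (cong (_/ 2) (k+1≡ b)) (m*n/n≡m (suc b) 2)
  lhs : ∀ a b → 2 * (suc (a + a) + suc b) ≡ suc (a + a) + suc (a + a) + suc (b + b) + 1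
  lhs = solve-∀
  rhs : ∀ a b c → suc (a + a) + suc (c + c) * suc (b + b) + suc (b + b) + 1
                  ≡ 2 * (suc a + suc (b + b) * suc c)
  rhs = solve-∀
  doubled : 2 * (suc (a + a) + suc b) ≡ 2 * (suc a + suc (b + b) * suc c)
  doubled = begin
    2 * (suc (a + a) + suc b)                                    ≡⟨ lhs a b ⟩
    suc (a + a) + suc (a + a) + suc (b + b) + 1                  ≡⟨ cong (λ m → suc (a + a) + m + suc (b + b) + 1) n≡qk ⟩
    suc (a + a) + suc (c + c) * suc (b + b) + suc (b + b) + 1    ≡⟨ rhs a b c ⟩
    2 * (suc a + suc (b + b) * suc c)                            ∎

proposition17 : (n k : ℕ) .{{_ : NonZero n}} → n % 2 ≡ 1 → k % 2 ≡ 1 → 1 ≤ k → 2 * k < n → k ∣ n →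
    IsMinVertexCoverSize (Petersen n k) (n + (k + 1) / 2)
proposition17 n k n-odd k-odd _ _ (divides q n≡qk)
  with odd-half n-odd | odd-half k-odd
     | odd-half {q} (odd-cofactor {q} {k} (subst (λ m → m % 2 ≡ 1) n≡qk n-odd) k-odd)
... | a , n≡2a+1 | b , k≡2b+1 | c , q≡2c+1 = (cover , is-cover , cover-size) , minimal
  where
  n≡ : n ≡ suc (c + c) * k
  n≡ = trans n≡qk (cong (_* k) q≡2c+1)

  value : n + (k + 1) / 2 ≡ suc a + k * suc c
  value = target-value {a = a} {b} {c} n≡2a+1 k≡2b+1 n≡

  n≡2ck+k : n ≡ c * k + c * k + k
  n≡2ck+k = trans n≡ (trans (+-comm k _) (cong (_+ k) (*-distribʳ-+ k c c)))

  open EvenOddCover n k b (c * k) k≡2b+1 n≡2ck+k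

  cover-size : ∣ cover ∣ ≡ n + (k + 1) / 2
  cover-size = trans (size a n≡2a+1)
    (trans (cong (suc a +_) (trans (+-comm (c * k) k) (trans (cong (k +_) (*-comm c k)) (sym (*-suc k c)))))
           (sym value))

  minimal : ∀ S → IsVertexCover (Petersen n k) S → n + (k + 1) / 2 ≤ ∣ S ∣
  minimal S cov = subst (_≤ ∣ S ∣) (sym value) (LowerBound.lower-bound n k cov a c n≡2a+1 n≡)
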